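{- For every positive integer $n$, the number of partitions $\lambda$ of $n$ such that $c^\lambda_{sp}(u)\ne 0$ for all cells $u\in\lambda$ equals the number of partitions of $n$ all of whose parts are congruent to $2 \bmod 4$.
   Context: For a partition $\lambda$ with conjugate $\lambda'$ (cells $(i,j)$ = row $i$, column $j$ of the Young diagram; $\lambda_i=0$ beyond the length), the symplectic content of a cell $(i,j)\in\lambda$ is $c^\lambda_{sp}(i,j)=\lambda_i+\lambda_j-i-j+2$ if $i>j$, and $c^\lambda_{sp}(i,j)=i+j-\lambda'_i-\lambda'_j$ if $i\le j$. -}

module Defs where

open import Data.Nat as ℕ using (ℕ; zero; suc; _≤_; _<_; _≥_; _≤?_; _%_)
open import Data.Integer as ℤ using (ℤ; +_)
open import Data.List using (List; []; _∷_; _++_; map; upTo; filter; length)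
open import Data.Nat.ListAction using (sum)
open import Data.List.Relation.Unary.All using (All)
open import Data.List.Relation.Unary.Linked using (Linked)
open import Data.Product using (Σ; _×_; _,_)
open import Relation.Binary.PropositionalEquality using (_≡_)
open import Relation.Nullary using (does)
open import Data.Bool using (if_then_else_)

record IsPartition (n : ℕ) (λs : List ℕ) : Set where
  field
    decreasing : Linked _≥_ λs
    positive   : All (λ p → 0 < p) λs
    sums       : sum λs ≡ n

Partition : ℕ → Set
Partition n = Σ (List ℕ) (IsPartition n)

-- λ_i (1-indexed), with λ_i = 0 beyond the length.
part : List ℕ → ℕ → ℕ
part []       _             = 0
part (p ∷ ps) zero          = 0          -- index 0 is never used
part (p ∷ ps) (suc zero)    = p
part (p ∷ ps) (suc (suc i)) = part ps (suc i)

conj : List ℕ → ℕ → ℕ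
conj λs j = length (filter (j ≤?_) λs)

-- symplectic content of cell (i , j) (row i, column j, 1-indexed):
--   λ_i + λ_j - i - j + 2   if i > j,
--   i + j - λ'_i - λ'_j     if i ≤ j.
csp : List ℕ → ℕ → ℕ → ℤ
csp λs i j =
  if does (j ℕ.<? i)
  then (+ (part λs i ℕ.+ part λs j ℕ.+ 2)) ℤ.- (+ (i ℕ.+ j))
  else (+ (i ℕ.+ j)) ℤ.- (+ (conj λs i ℕ.+ conj λs j))

-- cells of the Young diagram, (row , column), 1-indexed
rowsFrom : ℕ → List ℕ → List (ℕ × ℕ)
rowsFrom i []       = []
rowsFrom i (p ∷ ps) = map (λ j → (i , suc j)) (upTo p) ++ rowsFrom (suc i) ps

cells : List ℕ → List (ℕ × ℕ)
cells λs = rowsFrom 1 λs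

NoZeroSpContent : List ℕ → Set
NoZeroSpContent λs = All (λ { (i , j) → ℤ.NonZero (csp λs i j) }) (cells λs)

AllParts2mod4 : List ℕ → Set
AllParts2mod4 λs = All (λ p → p % 4 ≡ 2) λs

module Submission where

-- A partition has no vanishing symplectic content exactly when it is the doubled shape of a
-- strict partition μ, which has size 2|μ|.  Removing the first row and column of λ shifts both
-- terms of every remaining content by 2, so the inner cells are unaffected; the cells of the
-- removed hook all have nonzero content iff its leg is one cell longer than its arm, since
-- otherwise the corner of the arm or the foot of the leg has content 0.  Glaisher's bijection
-- then matches strict partitions of m with partitions of m into odd parts, and doubling those
-- parts gives exactly the partitions of 2m into parts ≡ 2 (mod 4).

open import Axiom.UniquenessOfIdentityProofs using (module Decidable⇒UIP)
open import Data.Bool using (true; false; if_then_else_)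
open import Data.Empty using (⊥-elim)
open import Data.Integer as ℤ using ()
import Data.Integer.Properties as ℤ
open import Data.List using (List; []; _∷_; _++_; map; filter; length; replicate; merge)
open import Data.List.Properties
  using ( ∷-injectiveˡ; ∷-injectiveʳ; length-++; length-++-≤ˡ; length-map; length-replicate
        ; map-∘; map-cong; map-id; map-id-local; filter-++; filter-accept; filter-reject
        ; filter-all; filter-none)
open import Data.List.Relation.Binary.Permutation.Propositional using (↭-sym)
open import Data.List.Relation.Binary.Permutation.Propositional.Properties
  using (merge-↭; All-resp-↭)
open import Data.List.Relation.Unary.All as All using (All; []; _∷_)
import Data.List.Relation.Unary.All.Properties as All
open import Data.List.Relation.Unary.Linked as Linked using (Linked; []; [-]; _∷_)
open import Data.List.Relation.Unary.Linked.Properties as Linked using (Linked⇒All)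
import Data.List.Relation.Unary.Sorted.TotalOrder.Properties as Sorted
open import Data.Nat as ℕ
  using ( ℕ; zero; suc; _+_; _∸_; _%_; _≤_; _<_; _≥_; _>_; _<?_; _≥?_; _≟_; z≤n; s≤s
        ; NonZero; parity; ⌊_/2⌋)
open import Data.Nat.DivMod using ([m+n]%n≡m%n)
open import Data.Nat.ListAction using (sum)
open import Data.Nat.ListAction.Properties using (sum-++; sum-↭)
open import Data.Nat.Properties
open import Data.Nat.Tactic.RingSolver using (solve-∀)
open import Data.Parity.Base as ℙ using (1ℙ)
import Data.Parity.Properties as ℙ
open import Data.Product using (Σ; Σ-syntax; _×_; _,_; proj₁; proj₂; map₁; map₂)
open import Function using (_∘_; _⇔_; mk⇔; Equivalence; _↔_; mk↔ₛ′)
open import Function.Properties.Inverse using (↔-trans)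
open import Level using (0ℓ)
open import Relation.Binary.Definitions using (Transitive; tri<; tri≈; tri>)
open import Relation.Binary.Properties.DecTotalOrder ≤-decTotalOrder using (≥-decTotalOrder)
open import Relation.Binary.PropositionalEquality
open import Relation.Nullary using (¬_; does; yes; no; Irrelevant)
open import Relation.Nullary.Decidable using (dec-true; dec-false)
open import Relation.Unary using (Pred; Decidable; ∁)
open import Relation.Unary.Properties using (∁?)

open import Defs

≥-trans : Transitive _≥_
≥-trans x≥y y≥z = ≤-trans y≥z x≥y

>-trans : Transitive _>_
>-trans x>y y>z = <-trans y>z x>y

∷-Linked : ∀ {A : Set} {R : A → A → Set} {x xs} → All (R x) xs → Linked R xs → Linked R (x ∷ xs)
∷-Linked {xs = []}    _         _ = [-]
∷-Linked {xs = _ ∷ _} (Rxy ∷ _) l = Rxy ∷ l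

∷-Linked⁻ : ∀ {A : Set} {R : A → A → Set} {x xs} → Transitive R → Linked R (x ∷ xs) → All (R x) xs
∷-Linked⁻ trans [-]       = []
∷-Linked⁻ trans (Rxy ∷ l) = Linked⇒All trans Rxy l

Linked≥⇒All< : ∀ {x y r} → y < x → Linked _≥_ (y ∷ r) → All (_< x) (y ∷ r)
Linked≥⇒All< y<x yr↓ = y<x ∷ All.map (λ z≤y → ≤-<-trans z≤y y<x) (∷-Linked⁻ ≥-trans yr↓)

replicate-Linked : ∀ {A : Set} {R : A → A → Set} {x} k → R x x → Linked R (replicate k x)
replicate-Linked zero          _   = []
replicate-Linked (suc zero)    _   = [-]
replicate-Linked (suc (suc k)) Rxx = Rxx ∷ replicate-Linked (suc k) Rxx

++-replicate-Linked : ∀ {x} xs k → Linked _≥_ xs → All (x ≤_) xs →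
  Linked _≥_ (xs ++ replicate k x)
++-replicate-Linked []       k _   _             = replicate-Linked k ≤-refl
++-replicate-Linked (y ∷ xs) k xs↓ (x≤y ∷ x≤xs) = ∷-Linked
  (All.++⁺ (∷-Linked⁻ ≥-trans xs↓) (All.replicate⁺ k x≤y))
  (++-replicate-Linked xs k (Linked.tail xs↓) x≤xs)

sum-map-suc : ∀ xs → sum (map suc xs) ≡ sum xs + length xs
sum-map-suc []       = refl
sum-map-suc (x ∷ xs) = begin
  suc (x + sum (map suc xs))       ≡⟨ cong (λ t → suc (x + t)) (sum-map-suc xs) ⟩
  suc (x + (sum xs + length xs))   ≡⟨ cong suc (+-assoc x _ _) ⟨
  suc (x + sum xs + length xs)     ≡⟨ +-suc _ (length xs) ⟨
  x + sum xs + suc (length xs)     ∎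
  where open ≡-Reasoning

sum-replicate-1 : ∀ k → sum (replicate k 1) ≡ k
sum-replicate-1 zero    = refl
sum-replicate-1 (suc k) = cong suc (sum-replicate-1 k)

suc-+-suc : ∀ a b → suc a + suc b ≡ 2 + (a + b)
suc-+-suc a b = cong suc (+-suc a b)

Σ-≡ : ∀ {A : Set} {P : A → Set} → (∀ a → Irrelevant (P a)) →
  {x y : Σ A P} → proj₁ x ≡ proj₁ y → x ≡ y
Σ-≡ irr {a , p} {.a , q} refl = cong (a ,_) (irr a p q)

part-++ˡ : ∀ xs ys i → i < length xs → part (xs ++ ys) (suc i) ≡ part xs (suc i)
part-++ˡ (x ∷ xs) ys zero    _          = refl
part-++ˡ (x ∷ xs) ys (suc i) (s≤s i<xs) = part-++ˡ xs ys i i<xs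

part-++ʳ : ∀ xs ys i → length xs ≤ i → part (xs ++ ys) (suc i) ≡ part ys (suc (i ∸ length xs))
part-++ʳ []       ys i       _          = refl
part-++ʳ (x ∷ xs) ys (suc i) (s≤s xs≤i) = part-++ʳ xs ys i xs≤i

part-map : ∀ f xs i → i < length xs → part (map f xs) (suc i) ≡ f (part xs (suc i))
part-map f (x ∷ xs) zero    _          = refl
part-map f (x ∷ xs) (suc i) (s≤s i<xs) = part-map f xs i i<xs

part-replicate : ∀ k x i → i < k → part (replicate k x) (suc i) ≡ x
part-replicate (suc k) x zero    _         = refl
part-replicate (suc k) x (suc i) (s≤s i<k) = part-replicate k x i i<k

part-replicate-≤ : ∀ k x i → part (replicate k x) i ≤ x
part-replicate-≤ zero    x i             = z≤n
part-replicate-≤ (suc k) x zero          = z≤n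
part-replicate-≤ (suc k) x (suc zero)    = ≤-refl
part-replicate-≤ (suc k) x (suc (suc i)) = part-replicate-≤ k x (suc i)

part>0⇒<length : ∀ xs i → 0 < part xs (suc i) → i < length xs
part>0⇒<length (x ∷ xs) zero    _ = s≤s z≤n
part>0⇒<length (x ∷ xs) (suc i) p = s≤s (part>0⇒<length xs i p)

All-part : ∀ {P : ℕ → Set} {xs} i → All P xs → i < length xs → P (part xs (suc i))
All-part zero    (px ∷ _)   _          = px
All-part (suc i) (_  ∷ pxs) (s≤s i<xs) = All-part i pxs i<xs

conj-++ : ∀ xs ys j → conj (xs ++ ys) j ≡ conj xs j + conj ys j
conj-++ xs ys j = trans (cong length (filter-++ (j ℕ.≤?_) xs ys)) (length-++ (filter (j ℕ.≤?_) xs))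

conj-∷-≤ : ∀ {x} xs j → j ≤ x → conj (x ∷ xs) j ≡ suc (conj xs j)
conj-∷-≤ xs j j≤x = cong length (filter-accept (j ℕ.≤?_) j≤x)

conj-∷-> : ∀ {x} xs j → x < j → conj (x ∷ xs) j ≡ conj xs j
conj-∷-> xs j x<j = cong length (filter-reject (j ℕ.≤?_) (<⇒≱ x<j))

conj-map-suc : ∀ xs j → conj (map suc xs) (suc j) ≡ conj xs j
conj-map-suc []       j = refl
conj-map-suc (x ∷ xs) j with j ℕ.≤? x
... | yes j≤x = trans (conj-∷-≤ (map suc xs) (suc j) (s≤s j≤x))
                      (trans (cong suc (conj-map-suc xs j)) (sym (conj-∷-≤ xs j j≤x)))
... | no  j≰x = trans (conj-∷-> (map suc xs) (suc j) (s≤s (≰⇒> j≰x)))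
                      (trans (conj-map-suc xs j) (sym (conj-∷-> xs j (≰⇒> j≰x))))

conj-all-< : ∀ {xs} j → All (_< j) xs → conj xs j ≡ 0
conj-all-< j all = cong length (filter-none (j ℕ.≤?_) (All.map <⇒≱ all))

conj-all-≥ : ∀ {xs} j → All (j ≤_) xs → conj xs j ≡ length xs
conj-all-≥ j all = cong length (filter-all (j ℕ.≤?_) all)

csp⁺ csp⁻ : List ℕ → ℕ → ℕ → ℕ
csp⁺ λs i j = if does (j <? i) then part λs i + part λs j + 2 else i + j
csp⁻ λs i j = if does (j <? i) then i + j else conj λs i + conj λs j

csp≡csp⁺-csp⁻ : ∀ λs i j → csp λs i j ≡ ℤ.+ csp⁺ λs i j ℤ.- ℤ.+ csp⁻ λs i j
csp≡csp⁺-csp⁻ λs i j with does (j <? i)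
... | true  = refl
... | false = refl

module _ (λs : List ℕ) {i j : ℕ} where

  private
    if-true : ∀ {b} {x y : ℕ} → b ≡ true → (if b then x else y) ≡ x
    if-true refl = refl

    if-false : ∀ {b} {x y : ℕ} → b ≡ false → (if b then x else y) ≡ y
    if-false refl = refl

  csp⁺-< : j < i → csp⁺ λs i j ≡ part λs i + part λs j + 2
  csp⁺-< j<i = if-true (dec-true (j <? i) j<i)

  csp⁺-≥ : i ≤ j → csp⁺ λs i j ≡ i + j
  csp⁺-≥ i≤j = if-false (dec-false (j <? i) (≤⇒≯ i≤j))

  csp⁻-< : j < i → csp⁻ λs i j ≡ i + j
  csp⁻-< j<i = if-true (dec-true (j <? i) j<i)

  csp⁻-≥ : i ≤ j → csp⁻ λs i j ≡ conj λs i + conj λs j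
  csp⁻-≥ i≤j = if-false (dec-false (j <? i) (≤⇒≯ i≤j))

+a-+b-nonZero⇔a≢b : ∀ a b → ℤ.NonZero (ℤ.+ a ℤ.- ℤ.+ b) ⇔ (a ≢ b)
+a-+b-nonZero⇔a≢b a b = mk⇔
  (λ { nz refl → ℕ.≢-nonZero⁻¹ 0 {{subst ℤ.NonZero (ℤ.+-inverseʳ (ℤ.+ a)) nz}} refl })
  (λ a≢b → ℤ.≢-nonZero (a≢b ∘ ℤ.+-injective ∘ ℤ.i-j≡0⇒i≡j _ _))

-- Cells are indexed from 0 here: (i , j) stands for row 1 + i, column 1 + j.
NoZeroSpContent′ : List ℕ → Set
NoZeroSpContent′ λs =
  ∀ i j → j < part λs (suc i) → csp⁺ λs (suc i) (suc j) ≢ csp⁻ λs (suc i) (suc j)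

All-rowsFrom⇔ : ∀ {P : ℕ × ℕ → Set} s ps →
  All P (rowsFrom s ps) ⇔ (∀ i j → j < part ps (suc i) → P (s + i , suc j))
All-rowsFrom⇔ {P} s ps = mk⇔ (to s ps) (from s ps)
  where
  to : ∀ s ps → All P (rowsFrom s ps) → ∀ i j → j < part ps (suc i) → P (s + i , suc j)
  to s (p ∷ ps) all zero    j j<p = subst (λ r → P (r , suc j)) (sym (+-identityʳ s))
    (All.applyUpTo⁻ _ p (All.map⁻ (All.++⁻ˡ _ all)) j<p)
  to s (p ∷ ps) all (suc i) j j<p = subst (λ r → P (r , suc j)) (sym (+-suc s i))
    (to (suc s) ps (All.++⁻ʳ _ all) i j j<p)

  from : ∀ s ps → (∀ i j → j < part ps (suc i) → P (s + i , suc j)) → All P (rowsFrom s ps)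
  from s []       _ = []
  from s (p ∷ ps) h = All.++⁺
    (All.map⁺ (All.applyUpTo⁺₁ _ p λ {j} j<p →
      subst (λ r → P (r , suc j)) (+-identityʳ s) (h 0 j j<p)))
    (from (suc s) ps λ i j j<p → subst (λ r → P (r , suc j)) (+-suc s i) (h (suc i) j j<p))

NoZeroSpContent⇔′ : ∀ λs → NoZeroSpContent λs ⇔ NoZeroSpContent′ λs
NoZeroSpContent⇔′ λs = mk⇔
  (λ nz i j j<p → to (nonZero⇔≢ (suc i) (suc j)) (to (All-rowsFrom⇔ 1 λs) nz i j j<p))
  (λ nz → from (All-rowsFrom⇔ 1 λs) λ i j j<p → from (nonZero⇔≢ (suc i) (suc j)) (nz i j j<p))
  where
  open Equivalence
  nonZero⇔≢ : ∀ i j → ℤ.NonZero (csp λs i j) ⇔ (csp⁺ λs i j ≢ csp⁻ λs i j)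
  nonZero⇔≢ i j rewrite csp≡csp⁺-csp⁻ λs i j = +a-+b-nonZero⇔a≢b _ _

-- Adding a hook

-- The partition with first row m and first column of length 1 + length ν + k,
-- enclosing ν shifted diagonally by one cell.
addHook : ℕ → List ℕ → ℕ → List ℕ
addHook m ν k = m ∷ map suc ν ++ replicate k 1

module _ (m : ℕ) (ν : List ℕ) (k : ℕ) where

  length-addHook : length (addHook m ν k) ≡ suc (length ν + k)
  length-addHook = cong suc (trans (length-++ (map suc ν))
                                   (cong₂ _+_ (length-map suc ν) (length-replicate k)))

  addHook-positive : 0 < m → All (0 <_) (addHook m ν k)
  addHook-positive 0<m =
    0<m ∷ All.++⁺ (All.map⁺ (All.universal (λ _ → s≤s z≤n) ν)) (All.replicate⁺ k (s≤s z≤n))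

  addHook-decreasing : 0 < m → All (_< m) ν → Linked _≥_ ν → Linked _≥_ (addHook m ν k)
  addHook-decreasing 0<m ν<m ν↓ = ∷-Linked
    (All.++⁺ (All.map⁺ ν<m) (All.replicate⁺ k 0<m))
    (++-replicate-Linked (map suc ν) k (Linked.map⁺ (Linked.map s≤s ν↓))
                                       (All.map⁺ (All.universal (λ _ → s≤s z≤n) ν)))

  addHook-decreasing⁻ : Linked _≥_ (addHook m ν k) → All (_< m) ν
  addHook-decreasing⁻ λ↓ = All.map⁻ (All.++⁻ˡ (map suc ν) (∷-Linked⁻ ≥-trans λ↓))

  sum-addHook : sum (addHook m ν k) ≡ m + (sum ν + (length ν + k))
  sum-addHook = cong (m +_) (begin
    sum (map suc ν ++ replicate k 1)        ≡⟨ sum-++ (map suc ν) _ ⟩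
    sum (map suc ν) + sum (replicate k 1)   ≡⟨ cong₂ _+_ (sum-map-suc ν) (sum-replicate-1 k) ⟩
    sum ν + length ν + k                    ≡⟨ +-assoc (sum ν) _ _ ⟩
    sum ν + (length ν + k)                  ∎)
    where open ≡-Reasoning

  part-addHook-inner : ∀ i → i < length ν → part (addHook m ν k) (2 + i) ≡ suc (part ν (suc i))
  part-addHook-inner i i<ν =
    trans (part-++ˡ (map suc ν) _ i (subst (i <_) (sym (length-map suc ν)) i<ν))
          (part-map suc ν i i<ν)

  part-addHook-leg : ∀ i → length ν ≤ i →
    part (addHook m ν k) (2 + i) ≡ part (replicate k 1) (suc (i ∸ length ν))
  part-addHook-leg i ν≤i =
    trans (part-++ʳ (map suc ν) _ i (subst (_≤ i) (sym (length-map suc ν)) ν≤i))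
          (cong (λ l → part (replicate k 1) (suc (i ∸ l))) (length-map suc ν))

  conj-addHook-1 : 0 < m → conj (addHook m ν k) 1 ≡ suc (length ν + k)
  conj-addHook-1 0<m = trans (conj-all-≥ 1 (addHook-positive 0<m)) length-addHook

  conj-addHook : ∀ j → 2 + j ≤ m → conj (addHook m ν k) (2 + j) ≡ suc (conj ν (suc j))
  conj-addHook j 2+j≤m = begin
    conj (addHook m ν k) (2 + j)                       ≡⟨ conj-∷-≤ _ (2 + j) 2+j≤m ⟩
    suc (conj (map suc ν ++ replicate k 1) (2 + j))    ≡⟨ cong suc (conj-++ (map suc ν) _ (2 + j)) ⟩
    suc (conj (map suc ν) (2 + j) + conj (replicate k 1) (2 + j))
      ≡⟨ cong₂ (λ a b → suc (a + b)) (conj-map-suc ν (suc j))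
                                     (conj-all-< (2 + j) (All.replicate⁺ k (s≤s (s≤s z≤n)))) ⟩
    suc (conj ν (suc j) + 0)                           ≡⟨ cong suc (+-identityʳ _) ⟩
    suc (conj ν (suc j))                               ∎
    where open ≡-Reasoning

  csp⁺-addHook : ∀ i j → j < part ν (suc i) →
    csp⁺ (addHook m ν k) (2 + i) (2 + j) ≡ 2 + csp⁺ ν (suc i) (suc j)
  csp⁺-addHook i j j<p with j <? i
  ... | yes j<i = begin
    csp⁺ (addHook m ν k) (2 + i) (2 + j)                 ≡⟨ csp⁺-< (addHook m ν k) (s≤s (s≤s j<i)) ⟩
    part (addHook m ν k) (2 + i) + part (addHook m ν k) (2 + j) + 2
      ≡⟨ cong₂ (λ a b → a + b + 2) (part-addHook-inner i i<ν)
                                   (part-addHook-inner j (<-trans j<i i<ν)) ⟩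
    suc (part ν (suc i)) + suc (part ν (suc j)) + 2      ≡⟨ cong (_+ 2) (suc-+-suc _ _) ⟩
    2 + (part ν (suc i) + part ν (suc j) + 2)            ≡⟨ cong (2 +_) (csp⁺-< ν (s≤s j<i)) ⟨
    2 + csp⁺ ν (suc i) (suc j)                           ∎
    where
    open ≡-Reasoning
    i<ν = part>0⇒<length ν i (≤-trans (s≤s z≤n) j<p)
  ... | no j≮i = begin
    csp⁺ (addHook m ν k) (2 + i) (2 + j)  ≡⟨ csp⁺-≥ (addHook m ν k) (s≤s (s≤s (≮⇒≥ j≮i))) ⟩
    (2 + i) + (2 + j)                     ≡⟨ suc-+-suc (suc i) (suc j) ⟩
    2 + (suc i + suc j)                   ≡⟨ cong (2 +_) (csp⁺-≥ ν (s≤s (≮⇒≥ j≮i))) ⟨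
    2 + csp⁺ ν (suc i) (suc j)            ∎
    where open ≡-Reasoning

  csp⁻-addHook : All (_< m) ν → ∀ i j → j < part ν (suc i) →
    csp⁻ (addHook m ν k) (2 + i) (2 + j) ≡ 2 + csp⁻ ν (suc i) (suc j)
  csp⁻-addHook ν<m i j j<p with j <? i
  ... | yes j<i = begin
    csp⁻ (addHook m ν k) (2 + i) (2 + j)  ≡⟨ csp⁻-< (addHook m ν k) (s≤s (s≤s j<i)) ⟩
    (2 + i) + (2 + j)                     ≡⟨ suc-+-suc (suc i) (suc j) ⟩
    2 + (suc i + suc j)                   ≡⟨ cong (2 +_) (csp⁻-< ν (s≤s j<i)) ⟨
    2 + csp⁻ ν (suc i) (suc j)            ∎
    where open ≡-Reasoning
  ... | no j≮i = begin
    csp⁻ (addHook m ν k) (2 + i) (2 + j)                 ≡⟨ csp⁻-≥ (addHook m ν k) (s≤s (s≤s i≤j)) ⟩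
    conj (addHook m ν k) (2 + i) + conj (addHook m ν k) (2 + j)
      ≡⟨ cong₂ _+_ (conj-addHook i (≤-trans (s≤s (s≤s i≤j)) 2+j≤m)) (conj-addHook j 2+j≤m) ⟩
    suc (conj ν (suc i)) + suc (conj ν (suc j))          ≡⟨ suc-+-suc _ _ ⟩
    2 + (conj ν (suc i) + conj ν (suc j))                ≡⟨ cong (2 +_) (csp⁻-≥ ν (s≤s i≤j)) ⟨
    2 + csp⁻ ν (suc i) (suc j)                           ∎
    where
    open ≡-Reasoning
    i≤j = ≮⇒≥ j≮i
    2+j≤m : 2 + j ≤ m
    2+j≤m = ≤-trans (s≤s j<p) (All-part i ν<m (part>0⇒<length ν i (≤-trans (s≤s z≤n) j<p)))

  csp⁺<csp⁻-arm : 0 < m → length ν + k ≡ m → ∀ j → j < m →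
    csp⁺ (addHook m ν k) 1 (suc j) < csp⁻ (addHook m ν k) 1 (suc j)
  csp⁺<csp⁻-arm 0<m ν+k≡m j j<m = begin-strict
    csp⁺ (addHook m ν k) 1 (suc j)                          ≡⟨ csp⁺-≥ (addHook m ν k) (s≤s z≤n) ⟩
    2 + j                                                   ≤⟨ s≤s j<m ⟩
    suc m                                                   ≤⟨ m≤m+n (suc m) c ⟩
    suc m + c                                               <⟨ n<1+n _ ⟩
    suc (suc m + c)                                         ≡⟨ +-suc (suc m) c ⟨
    suc m + suc c
      ≡⟨ cong₂ _+_ (trans (conj-addHook-1 0<m) (cong suc ν+k≡m)) (conj-∷-≤ _ (suc j) j<m) ⟨
    conj (addHook m ν k) 1 + conj (addHook m ν k) (suc j)   ≡⟨ csp⁻-≥ (addHook m ν k) (s≤s z≤n) ⟨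
    csp⁻ (addHook m ν k) 1 (suc j)                          ∎
    where
    open ≤-Reasoning
    c = conj (map suc ν ++ replicate k 1) (suc j)

  csp⁻<csp⁺-leg : length ν + k ≡ m → ∀ i → 0 < part (addHook m ν k) (2 + i) →
    csp⁻ (addHook m ν k) (2 + i) 1 < csp⁺ (addHook m ν k) (2 + i) 1
  csp⁻<csp⁺-leg ν+k≡m i 0<p = begin-strict
    csp⁻ (addHook m ν k) (2 + i) 1          ≡⟨ csp⁻-< (addHook m ν k) (s≤s (s≤s z≤n)) ⟩
    (2 + i) + 1                            ≤⟨ +-monoˡ-≤ 1 (s≤s i<m) ⟩
    suc m + 1                              ≡⟨ +-suc m 1 ⟨
    m + 2                                  <⟨ n<1+n _ ⟩
    1 + m + 2                              ≤⟨ +-monoˡ-≤ 2 (+-monoˡ-≤ m 0<p) ⟩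
    part (addHook m ν k) (2 + i) + m + 2    ≡⟨ csp⁺-< (addHook m ν k) (s≤s (s≤s z≤n)) ⟨
    csp⁺ (addHook m ν k) (2 + i) 1          ∎
    where
    open ≤-Reasoning
    i<m : i < m
    i<m = ≤-pred (subst (suc i <_) (trans length-addHook (cong suc ν+k≡m))
                                   (part>0⇒<length (addHook m ν k) (suc i) 0<p))

  NoZeroSpContent′-addHook : 0 < m → All (_< m) ν → length ν + k ≡ m →
    NoZeroSpContent′ ν → NoZeroSpContent′ (addHook m ν k)
  NoZeroSpContent′-addHook 0<m _ ν+k≡m _ zero j j<m = <⇒≢ (csp⁺<csp⁻-arm 0<m ν+k≡m j j<m)
  NoZeroSpContent′-addHook _ _ ν+k≡m _ (suc i) zero 0<p = >⇒≢ (csp⁻<csp⁺-leg ν+k≡m i 0<p)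
  NoZeroSpContent′-addHook _ ν<m _ nz (suc i) (suc j) 1+j<p eq with i <? length ν
  ... | yes i<ν = nz i j j<p (+-cancelˡ-≡ 2 _ _ (begin
    2 + csp⁺ ν (suc i) (suc j)              ≡⟨ csp⁺-addHook i j j<p ⟨
    csp⁺ (addHook m ν k) (2 + i) (2 + j)    ≡⟨ eq ⟩
    csp⁻ (addHook m ν k) (2 + i) (2 + j)    ≡⟨ csp⁻-addHook ν<m i j j<p ⟩
    2 + csp⁻ ν (suc i) (suc j)              ∎))
    where
    open ≡-Reasoning
    j<p = ≤-pred (subst (suc j <_) (part-addHook-inner i i<ν) 1+j<p)
  ... | no i≮ν = <⇒≱ 1+j<p (begin
    part (addHook m ν k) (2 + i)                 ≡⟨ part-addHook-leg i (≮⇒≥ i≮ν) ⟩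
    part (replicate k 1) (suc (i ∸ length ν))    ≤⟨ part-replicate-≤ k 1 _ ⟩
    1                                           ≤⟨ s≤s z≤n ⟩
    suc j                                       ∎)
    where open ≤-Reasoning

  NoZeroSpContent′-addHook⁻ : All (_< m) ν → NoZeroSpContent′ (addHook m ν k) → NoZeroSpContent′ ν
  NoZeroSpContent′-addHook⁻ ν<m nz i j j<p eq = nz (suc i) (suc j)
    (subst (suc j <_) (sym (part-addHook-inner i (part>0⇒<length ν i (≤-trans (s≤s z≤n) j<p))))
           (s≤s j<p))
    (begin
      csp⁺ (addHook m ν k) (2 + i) (2 + j)    ≡⟨ csp⁺-addHook i j j<p ⟩
      2 + csp⁺ ν (suc i) (suc j)              ≡⟨ cong (2 +_) eq ⟩
      2 + csp⁻ ν (suc i) (suc j)              ≡⟨ csp⁻-addHook ν<m i j j<p ⟨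
      csp⁻ (addHook m ν k) (2 + i) (2 + j)    ∎)
    where open ≡-Reasoning

  -- A hook too short or too long leaves a cell of content zero at the end of its first row,
  -- resp. at the bottom of its first column.
  NoZeroSpContent′-addHook⇒length+k≡m : 0 < m → length ν ≤ m → All (_< length ν) ν →
    NoZeroSpContent′ (addHook m ν k) → length ν + k ≡ m
  NoZeroSpContent′-addHook⇒length+k≡m 0<m ν≤m ν<ν nz with <-cmp (length ν + k) m
  ... | tri≈ _ ν+k≡m _ = ν+k≡m
  ... | tri< ν+k<m _ _ = ⊥-elim (nz 0 (length ν + k) ν+k<m (begin
    csp⁺ (addHook m ν k) 1 (suc L)                         ≡⟨ csp⁺-≥ (addHook m ν k) (s≤s z≤n) ⟩
    1 + suc L                                             ≡⟨ +-comm 1 (suc L) ⟩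
    suc L + 1                                             ≡⟨ cong₂ _+_ (conj-addHook-1 0<m) corner ⟨
    conj (addHook m ν k) 1 + conj (addHook m ν k) (suc L)  ≡⟨ csp⁻-≥ (addHook m ν k) (s≤s z≤n) ⟨
    csp⁻ (addHook m ν k) 1 (suc L)                         ∎))
    where
    open ≡-Reasoning
    L = length ν + k
    ones< : ∀ n k → All (_< suc (n + k)) (replicate k 1)
    ones< n zero    = []
    ones< n (suc k) = All.replicate⁺ (suc k) (s≤s (≤-trans (s≤s z≤n) (m≤n+m (suc k) n)))
    corner : conj (addHook m ν k) (suc L) ≡ 1
    corner = trans (conj-∷-≤ _ (suc L) ν+k<m) (cong suc (conj-all-< (suc L) (All.++⁺
      (All.map⁺ (All.map (λ p<ν → s≤s (≤-trans p<ν (m≤m+n _ k))) ν<ν))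
      (ones< (length ν) k))))
  ... | tri> _ _ m<ν+k = ⊥-elim (nz (suc m) 0 (≤-reflexive (sym foot)) (begin
    csp⁺ (addHook m ν k) (2 + m) 1           ≡⟨ csp⁺-< (addHook m ν k) (s≤s (s≤s z≤n)) ⟩
    part (addHook m ν k) (2 + m) + m + 2     ≡⟨ cong (λ p → p + m + 2) foot ⟩
    1 + m + 2                               ≡⟨ cong suc (+-suc m 1) ⟩
    (2 + m) + 1                             ≡⟨ csp⁻-< (addHook m ν k) (s≤s (s≤s z≤n)) ⟨
    csp⁻ (addHook m ν k) (2 + m) 1           ∎))
    where
    open ≡-Reasoning
    foot : part (addHook m ν k) (2 + m) ≡ 1
    foot = trans (part-addHook-leg m ν≤m) (part-replicate k 1 (m ∸ length ν)
      (+-cancelˡ-< (length ν) _ _ (subst (_< length ν + k) (sym (m+[n∸m]≡n ν≤m)) m<ν+k)))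

-- Doubled strict partitions

Strict : List ℕ → Set
Strict μ = Linked _>_ μ × All (0 <_) μ

Strict-tail : ∀ {m μ} → Strict (m ∷ μ) → Strict μ
Strict-tail (μ↓ , _ ∷ μ>0) = Linked.tail μ↓ , μ>0

Strict-head : ∀ {m μ} → Strict (m ∷ μ) → All (_< m) μ
Strict-head (μ↓ , _) = ∷-Linked⁻ >-trans μ↓

Strict⇒decreasing : ∀ {μ} → Strict μ → Linked _≥_ μ
Strict⇒decreasing = Linked.map <⇒≤ ∘ proj₁

Strict-irrelevant : ∀ {μ} → Irrelevant (Strict μ)
Strict-irrelevant (μ↓ , μ>0) (μ↓′ , μ>0′) =
  cong₂ _,_ (Linked.irrelevant ≤-irrelevant μ↓ μ↓′) (All.irrelevant ≤-irrelevant μ>0 μ>0′)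

-- In Frobenius notation, doubled μ = (μ₁ - 1, μ₂ - 1, … | μ₁, μ₂, …).
doubled : List ℕ → List ℕ
doubled []      = []
doubled (m ∷ μ) = addHook m (doubled μ) (m ∸ length (doubled μ))

length-addHook-∸ : ∀ m ν → length ν ≤ m → length (addHook m ν (m ∸ length ν)) ≡ suc m
length-addHook-∸ m ν ν≤m = trans (length-addHook m ν (m ∸ length ν)) (cong suc (m+[n∸m]≡n ν≤m))

length-doubled≤ : ∀ {m μ} → Strict μ → All (_< m) μ → length (doubled μ) ≤ m
length-doubled≤ {μ = []}        _ _         = z≤n
length-doubled≤ {m} {x ∷ μ} s (x<m ∷ _) = subst (_≤ m)
  (sym (length-addHook-∸ x (doubled μ) (length-doubled≤ (Strict-tail s) (Strict-head s)))) x<m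

doubled-< : ∀ {m μ} → Strict μ → All (_< m) μ → All (_< m) (doubled μ)
doubled-< {μ = []}    _                 _         = []
doubled-< {μ = x ∷ μ} s@(_ , 0<x ∷ _) (x<m ∷ _) = x<m ∷ All.++⁺
  (All.map⁺ (All.map (λ p<x → <-≤-trans (s≤s p<x) x<m) (doubled-< (Strict-tail s) (Strict-head s))))
  (All.replicate⁺ _ (≤-<-trans 0<x x<m))

doubled-<-length : ∀ {μ} → Strict μ → All (_< length (doubled μ)) (doubled μ)
doubled-<-length {[]}    _ = []
doubled-<-length {x ∷ μ} s =
  subst (λ l → All (_< l) (doubled (x ∷ μ)))
        (sym (length-addHook-∸ x (doubled μ) (length-doubled≤ (Strict-tail s) (Strict-head s))))
        (doubled-< s (n<1+n x ∷ All.map m<n⇒m<1+n (Strict-head s)))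

doubled-decreasing : ∀ {μ} → Strict μ → Linked _≥_ (doubled μ)
doubled-decreasing {[]}    _                = []
doubled-decreasing {x ∷ μ} s@(_ , 0<x ∷ _) = addHook-decreasing x (doubled μ) _ 0<x
  (doubled-< (Strict-tail s) (Strict-head s)) (doubled-decreasing (Strict-tail s))

doubled-positive : ∀ {μ} → Strict μ → All (0 <_) (doubled μ)
doubled-positive {[]}    _              = []
doubled-positive {x ∷ μ} (_ , 0<x ∷ _) = addHook-positive x (doubled μ) _ 0<x

sum-doubled : ∀ {μ} → Strict μ → sum (doubled μ) ≡ sum μ + sum μ
sum-doubled {[]}    _ = refl
sum-doubled {x ∷ μ} s = begin
  sum (addHook x ν (x ∸ length ν))                ≡⟨ sum-addHook x ν _ ⟩
  x + (sum ν + (length ν + (x ∸ length ν)))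
    ≡⟨ cong₂ (λ a b → x + (a + b)) (sum-doubled (Strict-tail s)) (m+[n∸m]≡n ν≤x) ⟩
  x + (sum μ + sum μ + x)                         ≡⟨ rearrange x (sum μ) ⟩
  x + sum μ + (x + sum μ)                         ∎
  where
  open ≡-Reasoning
  ν = doubled μ
  ν≤x = length-doubled≤ (Strict-tail s) (Strict-head s)
  rearrange : ∀ a b → a + (b + b + a) ≡ a + b + (a + b)
  rearrange = solve-∀

doubled-NoZeroSpContent′ : ∀ {μ} → Strict μ → NoZeroSpContent′ (doubled μ)
doubled-NoZeroSpContent′ {[]}    _ _ _ ()
doubled-NoZeroSpContent′ {x ∷ μ} s@(_ , 0<x ∷ _) = NoZeroSpContent′-addHook x (doubled μ) _ 0<x
  (doubled-< (Strict-tail s) (Strict-head s))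
  (m+[n∸m]≡n (length-doubled≤ (Strict-tail s) (Strict-head s)))
  (doubled-NoZeroSpContent′ (Strict-tail s))

map-suc-++-ones-injective : ∀ {xs ys k l} → All (0 <_) xs → All (0 <_) ys →
  map suc xs ++ replicate k 1 ≡ map suc ys ++ replicate l 1 → xs ≡ ys
map-suc-++-ones-injective {[]}     {[]}              []         []         _  = refl
map-suc-++-ones-injective {x ∷ xs} {y ∷ ys}          (_ ∷ xs>0) (_ ∷ ys>0) eq = cong₂ _∷_
  (suc-injective (∷-injectiveˡ eq)) (map-suc-++-ones-injective xs>0 ys>0 (∷-injectiveʳ eq))
map-suc-++-ones-injective {x ∷ xs} {[]} {l = suc l} (0<x ∷ _)  []         eq =
  ⊥-elim (<⇒≢ 0<x (sym (suc-injective (∷-injectiveˡ eq))))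
map-suc-++-ones-injective {[]} {y ∷ ys} {k = suc k} []         (0<y ∷ _)  eq =
  ⊥-elim (<⇒≢ 0<y (suc-injective (∷-injectiveˡ eq)))

doubled-injective : ∀ {μ μ′} → Strict μ → Strict μ′ → doubled μ ≡ doubled μ′ → μ ≡ μ′
doubled-injective {[]}    {[]}      _ _  _  = refl
doubled-injective {x ∷ μ} {x′ ∷ μ′} s s′ eq = cong₂ _∷_ (∷-injectiveˡ eq)
  (doubled-injective (Strict-tail s) (Strict-tail s′)
    (map-suc-++-ones-injective (doubled-positive (Strict-tail s))
                               (doubled-positive (Strict-tail s′)) (∷-injectiveʳ eq)))

removeFirstColumn : ∀ {xs} → Linked _≥_ xs → All (0 <_) xs →
  Σ[ ν ∈ List ℕ ] Σ[ k ∈ ℕ ] xs ≡ map suc ν ++ replicate k 1 × Linked _≥_ ν × All (0 <_) ν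
removeFirstColumn {[]} _ _ = [] , 0 , refl , [] , []
removeFirstColumn {x ∷ xs} xs↓ (_ ∷ xs>0) with removeFirstColumn (Linked.tail xs↓) xs>0
removeFirstColumn {1 ∷ _}           _              _ | []    , k , refl , _  , _ =
  [] , suc k , refl , [] , []
removeFirstColumn {1 ∷ _}           (s≤s y≤0 ∷ _) _ | y ∷ _ , _ , refl , _  , 0<y ∷ _ =
  ⊥-elim (<⇒≱ 0<y y≤0)
removeFirstColumn {suc (suc x) ∷ _} _              _ | []    , k , refl , _  , _ =
  suc x ∷ [] , k , refl , [-] , s≤s z≤n ∷ []
removeFirstColumn {suc (suc x) ∷ _} (s≤s y≤x ∷ _) _ | y ∷ ν , k , refl , ν↓ , ν>0 =
  suc x ∷ y ∷ ν , k , refl , y≤x ∷ ν↓ , s≤s z≤n ∷ ν>0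

∷-Strict : ∀ {m μ} → 0 < m → All (_< m) (doubled μ) → Strict μ → Strict (m ∷ μ)
∷-Strict {μ = []}    0<m _         _          = [-] , 0<m ∷ []
∷-Strict {μ = x ∷ μ} 0<m (x<m ∷ _) (μ↓ , μ>0) = x<m ∷ μ↓ , 0<m ∷ μ>0

NoZeroSpContent′⇒doubled : ∀ f {λs} → length λs ≤ f → Linked _≥_ λs → All (0 <_) λs →
  NoZeroSpContent′ λs → Σ[ μ ∈ List ℕ ] Strict μ × λs ≡ doubled μ
NoZeroSpContent′⇒doubled _ {[]} _ _ _ _ = [] , ([] , []) , refl
NoZeroSpContent′⇒doubled (suc f) {m ∷ _} (s≤s len≤f) λ↓ (0<m ∷ rest>0) nz
  with removeFirstColumn (Linked.tail λ↓) rest>0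
... | ν , k , refl , ν↓ , ν>0
  with NoZeroSpContent′⇒doubled f
         (≤-trans (≤-trans (≤-reflexive (sym (length-map suc ν))) (length-++-≤ˡ (map suc ν))) len≤f)
         ν↓ ν>0 (NoZeroSpContent′-addHook⁻ m ν k (addHook-decreasing⁻ m ν k λ↓) nz)
... | μ , sμ , refl = m ∷ μ , s , cong (addHook m (doubled μ)) k≡m∸dμ
  where
  s : Strict (m ∷ μ)
  s = ∷-Strict 0<m (addHook-decreasing⁻ m (doubled μ) k λ↓) sμ
  k≡m∸dμ : k ≡ m ∸ length (doubled μ)
  k≡m∸dμ = trans (sym (m+n∸m≡n (length (doubled μ)) k)) (cong (_∸ length (doubled μ))
    (NoZeroSpContent′-addHook⇒length+k≡m m (doubled μ) k 0<m (length-doubled≤ sμ (Strict-head s))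
                                                              (doubled-<-length sμ) nz))

IsPartition-irrelevant : ∀ {n λs} → Irrelevant (IsPartition n λs)
IsPartition-irrelevant p q
  with Linked.irrelevant ≤-irrelevant (IsPartition.decreasing p) (IsPartition.decreasing q)
     | All.irrelevant ≤-irrelevant (IsPartition.positive p) (IsPartition.positive q)
     | ≡-irrelevant (IsPartition.sums p) (IsPartition.sums q)
... | refl | refl | refl = refl

Partition-≡ : ∀ {A : List ℕ → Set} {n} {x y : Σ (Partition n) (A ∘ proj₁)} →
  (∀ λs → Irrelevant (A λs)) → proj₁ (proj₁ x) ≡ proj₁ (proj₁ y) → x ≡ y
Partition-≡ irr eq = Σ-≡ (irr ∘ proj₁) (Σ-≡ (λ _ → IsPartition-irrelevant) eq)

nonZero-irrelevant : ∀ {n} → Irrelevant (NonZero n)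
nonZero-irrelevant {suc n} _ _ = refl

StrictHalfPartition : ℕ → Set
StrictHalfPartition n = Σ[ μ ∈ List ℕ ] Strict μ × sum μ + sum μ ≡ n

StrictHalfPartition-≡ : ∀ {n} {x y : StrictHalfPartition n} → proj₁ x ≡ proj₁ y → x ≡ y
StrictHalfPartition-≡ = Σ-≡ λ _ (s , eq) (s′ , eq′) →
  cong₂ _,_ (Strict-irrelevant s s′) (≡-irrelevant eq eq′)

noZeroSp↔strictHalf : ∀ n → Σ (Partition n) (NoZeroSpContent ∘ proj₁) ↔ StrictHalfPartition n
noZeroSp↔strictHalf n = mk↔ₛ′ to from to∘from from∘to
  where
  shape : (x : Σ (Partition n) (NoZeroSpContent ∘ proj₁)) →
    Σ[ μ ∈ List ℕ ] Strict μ × proj₁ (proj₁ x) ≡ doubled μ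
  shape ((λs , p) , nz) = NoZeroSpContent′⇒doubled (length λs) ≤-refl
    (IsPartition.decreasing p) (IsPartition.positive p) (Equivalence.to (NoZeroSpContent⇔′ λs) nz)

  to : Σ (Partition n) (NoZeroSpContent ∘ proj₁) → StrictHalfPartition n
  to x@((_ , p) , _) = let (μ , sμ , λs≡dμ) = shape x in
    μ , sμ , trans (sym (sum-doubled sμ)) (trans (cong sum (sym λs≡dμ)) (IsPartition.sums p))

  from : StrictHalfPartition n → Σ (Partition n) (NoZeroSpContent ∘ proj₁)
  from (μ , sμ , 2μ≡n) = (doubled μ , record
    { decreasing = doubled-decreasing sμ
    ; positive   = doubled-positive sμ
    ; sums       = trans (sum-doubled sμ) 2μ≡n
    }) , Equivalence.from (NoZeroSpContent⇔′ (doubled μ)) (doubled-NoZeroSpContent′ sμ)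

  to∘from : ∀ y → to (from y) ≡ y
  to∘from y@(μ , sμ , _) = let (_ , sμ′ , dμ≡dμ′) = shape (from y) in
    StrictHalfPartition-≡ (doubled-injective sμ′ sμ (sym dμ≡dμ′))

  from∘to : ∀ x → from (to x) ≡ x
  from∘to x = Partition-≡ (λ _ → All.irrelevant nonZero-irrelevant) (sym (proj₂ (proj₂ (shape x))))

merge≥ : List ℕ → List ℕ → List ℕ
merge≥ = merge _≥?_

merge≥-≥ : ∀ {x y} xs ys → x ≥ y → merge≥ (x ∷ xs) (y ∷ ys) ≡ x ∷ merge≥ xs (y ∷ ys)
merge≥-≥ {x} {y} _ _ x≥y rewrite dec-true (x ≥? y) x≥y = refl

merge≥-< : ∀ {x y} xs ys → x < y → merge≥ (x ∷ xs) (y ∷ ys) ≡ y ∷ merge≥ (x ∷ xs) ys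
merge≥-< {x} {y} _ _ x<y rewrite dec-false (x ≥? y) (<⇒≱ x<y) = refl

merge≥-[]ʳ : ∀ xs → merge≥ xs [] ≡ xs
merge≥-[]ʳ []      = refl
merge≥-[]ʳ (_ ∷ _) = refl

merge≥-∷ˡ : ∀ {x} xs ys → All (_≤ x) ys → merge≥ (x ∷ xs) ys ≡ x ∷ merge≥ xs ys
merge≥-∷ˡ {x} xs []       _         = cong (x ∷_) (sym (merge≥-[]ʳ xs))
merge≥-∷ˡ     xs (y ∷ ys) (y≤x ∷ _) = merge≥-≥ xs ys y≤x

merge≥-∷ʳ : ∀ {y} xs ys → All (_< y) xs → merge≥ xs (y ∷ ys) ≡ y ∷ merge≥ xs ys
merge≥-∷ʳ []       ys _         = refl
merge≥-∷ʳ (x ∷ xs) ys (x<y ∷ _) = merge≥-< xs ys x<y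

sum-merge≥ : ∀ xs ys → sum (merge≥ xs ys) ≡ sum xs + sum ys
sum-merge≥ xs ys = trans (sum-↭ (merge-↭ _≥?_ xs ys)) (sum-++ xs ys)

All-merge≥ : ∀ {P : Pred ℕ 0ℓ} {xs ys} → All P xs → All P ys → All P (merge≥ xs ys)
All-merge≥ {xs = xs} {ys} pxs pys = All-resp-↭ (↭-sym (merge-↭ _≥?_ xs ys)) (All.++⁺ pxs pys)

merge≥-decreasing : ∀ {xs ys} → Linked _≥_ xs → Linked _≥_ ys → Linked _≥_ (merge≥ xs ys)
merge≥-decreasing = Sorted.merge⁺ ≥-decTotalOrder

module _ {P : Pred ℕ 0ℓ} (P? : Decidable P) where

  merge≥-strict : ∀ xs ys → All (∁ P) xs → All P ys →
    Linked _>_ xs → Linked _>_ ys → Linked _>_ (merge≥ xs ys)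
  merge≥-strict []       ys       _            _          _   ys↓ = ys↓
  merge≥-strict (x ∷ xs) []       _            _          xs↓ _   = xs↓
  merge≥-strict (x ∷ xs) (y ∷ ys) (¬px ∷ ¬pxs) (py ∷ pys) xs↓ ys↓
    with x ≥? y | merge≥-strict xs (y ∷ ys) ¬pxs (py ∷ pys) (Linked.tail xs↓) ys↓
                | merge≥-strict (x ∷ xs) ys (¬px ∷ ¬pxs) pys xs↓ (Linked.tail ys↓)
  ... | yes x≥y | rec | _ = subst (Linked _>_) (sym (merge≥-≥ xs ys x≥y)) (∷-Linked
    (All-merge≥ (∷-Linked⁻ >-trans xs↓) (Linked≥⇒All< y<x (Linked.map <⇒≤ ys↓))) rec)
    where y<x = ≤∧≢⇒< x≥y (λ y≡x → ¬px (subst P y≡x py))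
  ... | no  x≱y | _ | rec = subst (Linked _>_) (sym (merge≥-< xs ys x<y)) (∷-Linked
    (All-merge≥ (Linked≥⇒All< x<y (Linked.map <⇒≤ xs↓)) (∷-Linked⁻ >-trans ys↓)) rec)
    where x<y = ≰⇒> x≱y

  filter-merge≥ : ∀ xs ys → All (∁ P) xs → All P ys →
    filter P? (merge≥ xs ys) ≡ ys × filter (∁? P?) (merge≥ xs ys) ≡ xs
  filter-merge≥ []       ys       _            pys        =
    filter-all P? pys , filter-none (∁? P?) (All.map (λ py ¬py → ¬py py) pys)
  filter-merge≥ (x ∷ xs) []       ¬pxs         _          =
    filter-none P? ¬pxs , filter-all (∁? P?) ¬pxs
  filter-merge≥ (x ∷ xs) (y ∷ ys) (¬px ∷ ¬pxs) (py ∷ pys)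
    with x ≥? y | filter-merge≥ xs (y ∷ ys) ¬pxs (py ∷ pys)
                | filter-merge≥ (x ∷ xs) ys (¬px ∷ ¬pxs) pys
  ... | yes x≥y | eq₁ , eq₂ | _ =
    trans (cong (filter P?) (merge≥-≥ xs ys x≥y)) (trans (filter-reject P? ¬px) eq₁) ,
    trans (cong (filter (∁? P?)) (merge≥-≥ xs ys x≥y))
          (trans (filter-accept (∁? P?) ¬px) (cong (x ∷_) eq₂))
  ... | no  x≱y | _ | eq₁ , eq₂ =
    trans (cong (filter P?) (merge≥-< xs ys (≰⇒> x≱y)))
          (trans (filter-accept P? py) (cong (y ∷_) eq₁)) ,
    trans (cong (filter (∁? P?)) (merge≥-< xs ys (≰⇒> x≱y)))
          (trans (filter-reject (∁? P?) (λ ¬py → ¬py py)) eq₂)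

  merge≥-filter : ∀ {xs} → Linked _≥_ xs → merge≥ (filter (∁? P?) xs) (filter P? xs) ≡ xs
  merge≥-filter {[]}     _   = refl
  merge≥-filter {x ∷ xs} xs↓ with P? x
  ... | yes px = trans
    (merge≥-∷ʳ _ _ (All.map below (All.zip (All.filter⁺ (∁? P?) (∷-Linked⁻ ≥-trans xs↓) ,
                                            All.all-filter (∁? P?) xs))))
    (cong (x ∷_) (merge≥-filter (Linked.tail xs↓)))
    where
    below : ∀ {y} → y ≤ x × ¬ P y → y < x
    below (y≤x , ¬py) = ≤∧≢⇒< y≤x (λ y≡x → ¬py (subst P (sym y≡x) px))
  ... | no ¬px = trans (merge≥-∷ˡ _ _ (All.filter⁺ P? (∷-Linked⁻ ≥-trans xs↓)))
                       (cong (x ∷_) (merge≥-filter (Linked.tail xs↓)))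

dup : ∀ {A : Set} → List A → List A
dup []       = []
dup (x ∷ xs) = x ∷ x ∷ dup xs

double : ℕ → ℕ
double n = n + n

All-dup : ∀ {A : Set} {P : Pred A 0ℓ} {xs} → All P xs → All P (dup xs)
All-dup []         = []
All-dup (px ∷ pxs) = px ∷ px ∷ All-dup pxs

dup-decreasing : ∀ {xs} → Linked _≥_ xs → Linked _≥_ (dup xs)
dup-decreasing []          = []
dup-decreasing {x ∷ xs} xs↓ =
  ≤-refl ∷ ∷-Linked (All-dup (∷-Linked⁻ ≥-trans xs↓)) (dup-decreasing (Linked.tail xs↓))

sum-dup : ∀ xs → sum (dup xs) ≡ double (sum xs)
sum-dup []       = refl
sum-dup (x ∷ xs) = trans (cong (λ s → x + (x + s)) (sum-dup xs)) (rearrange x (sum xs))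
  where
  rearrange : ∀ a b → a + (a + (b + b)) ≡ a + b + (a + b)
  rearrange = solve-∀

pairUp : List ℕ → List ℕ × List ℕ
pairUp []          = [] , []
pairUp (x ∷ [])    = x ∷ [] , []
pairUp (x ∷ y ∷ r) =
  if does (x ≟ y) then map₂ (x ∷_) (pairUp r) else map₁ (x ∷_) (pairUp (y ∷ r))

singles pairs : List ℕ → List ℕ
singles = proj₁ ∘ pairUp
pairs   = proj₂ ∘ pairUp

pairUp-≡ : ∀ x r → pairUp (x ∷ x ∷ r) ≡ map₂ (x ∷_) (pairUp r)
pairUp-≡ x r rewrite dec-true (x ≟ x) refl = refl

pairUp-≢ : ∀ {x y} r → x ≢ y → pairUp (x ∷ y ∷ r) ≡ map₁ (x ∷_) (pairUp (y ∷ r))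
pairUp-≢ {x} {y} r x≢y rewrite dec-false (x ≟ y) x≢y = refl

pairUp-∷ : ∀ {x} r → All (_< x) r → pairUp (x ∷ r) ≡ map₁ (x ∷_) (pairUp r)
pairUp-∷ []      _         = refl
pairUp-∷ (y ∷ r) (y<x ∷ _) = pairUp-≢ r (>⇒≢ y<x)

All-pairUp : ∀ {P : Pred ℕ 0ℓ} ν → All P ν → All P (singles ν) × All P (pairs ν)
All-pairUp []          _              = [] , []
All-pairUp (x ∷ [])    pν             = pν , []
All-pairUp (x ∷ y ∷ r) (px ∷ py ∷ pr)
  with x ≟ y | All-pairUp r pr | All-pairUp (y ∷ r) (py ∷ pr)
... | yes refl | ps , pp | _ rewrite pairUp-≡ x r   = ps , px ∷ pp
... | no  x≢y  | _ | ps , pp rewrite pairUp-≢ r x≢y = px ∷ ps , pp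

pairUp-decreasing : ∀ {ν} → Linked _≥_ ν → Linked _>_ (singles ν) × Linked _≥_ (pairs ν)
pairUp-decreasing {[]}        _ = [] , []
pairUp-decreasing {x ∷ []}    _ = [-] , []
pairUp-decreasing {x ∷ y ∷ r} (y≤x ∷ yr↓)
  with x ≟ y | pairUp-decreasing (Linked.tail yr↓) | pairUp-decreasing yr↓
... | yes refl | s↓ , p↓ | _ rewrite pairUp-≡ x r =
  s↓ , ∷-Linked (proj₂ (All-pairUp r (∷-Linked⁻ ≥-trans yr↓))) p↓
... | no  x≢y  | _ | s↓ , p↓ rewrite pairUp-≢ r x≢y =
  ∷-Linked (proj₁ (All-pairUp (y ∷ r) (Linked≥⇒All< (≤∧≢⇒< y≤x (x≢y ∘ sym)) yr↓))) s↓ , p↓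

merge≥-dup-pairUp : ∀ {ν} → Linked _≥_ ν → merge≥ (dup (pairs ν)) (singles ν) ≡ ν
merge≥-dup-pairUp {[]}        _ = refl
merge≥-dup-pairUp {x ∷ []}    _ = refl
merge≥-dup-pairUp {x ∷ y ∷ r} (y≤x ∷ yr↓)
  with x ≟ y | merge≥-dup-pairUp (Linked.tail yr↓) | merge≥-dup-pairUp yr↓
... | yes refl | rec | _ rewrite pairUp-≡ x r = begin
  merge≥ (x ∷ x ∷ dup (pairs r)) (singles r)    ≡⟨ merge≥-∷ˡ _ _ ≤x ⟩
  x ∷ merge≥ (x ∷ dup (pairs r)) (singles r)    ≡⟨ cong (x ∷_) (merge≥-∷ˡ _ _ ≤x) ⟩
  x ∷ x ∷ merge≥ (dup (pairs r)) (singles r)    ≡⟨ cong (λ t → x ∷ x ∷ t) rec ⟩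
  x ∷ x ∷ r                                     ∎
  where
  open ≡-Reasoning
  ≤x = proj₁ (All-pairUp r (∷-Linked⁻ ≥-trans yr↓))
... | no x≢y | _ | rec rewrite pairUp-≢ r x≢y = trans
  (merge≥-∷ʳ _ _ (All-dup (proj₂ (All-pairUp (y ∷ r) (Linked≥⇒All< (≤∧≢⇒< y≤x (x≢y ∘ sym)) yr↓)))))
  (cong (x ∷_) rec)

pairUp-merge≥-dup : ∀ A X → Linked _>_ A → Linked _≥_ X → pairUp (merge≥ (dup X) A) ≡ (A , X)
pairUp-merge≥-dup []      []      _  _  = refl
pairUp-merge≥-dup []      (x ∷ X) _  X↓ =
  trans (pairUp-≡ x (dup X)) (cong (map₂ (x ∷_))
    (trans (cong pairUp (sym (merge≥-[]ʳ (dup X)))) (pairUp-merge≥-dup [] X [] (Linked.tail X↓))))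
pairUp-merge≥-dup (a ∷ A) []      A↓ _  =
  trans (pairUp-∷ A (∷-Linked⁻ >-trans A↓))
        (cong (map₁ (a ∷_)) (pairUp-merge≥-dup A [] (Linked.tail A↓) []))
pairUp-merge≥-dup (a ∷ A) (x ∷ X) A↓ X↓
  with x ≥? a | pairUp-merge≥-dup (a ∷ A) X A↓ (Linked.tail X↓)
              | pairUp-merge≥-dup A (x ∷ X) (Linked.tail A↓) X↓
... | yes x≥a | rec | _ = begin
  pairUp (merge≥ (x ∷ x ∷ dup X) (a ∷ A))        ≡⟨ cong pairUp (merge≥-≥ (x ∷ dup X) A x≥a) ⟩
  pairUp (x ∷ merge≥ (x ∷ dup X) (a ∷ A))
    ≡⟨ cong (λ t → pairUp (x ∷ t)) (merge≥-≥ (dup X) A x≥a) ⟩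
  pairUp (x ∷ x ∷ merge≥ (dup X) (a ∷ A))        ≡⟨ pairUp-≡ x (merge≥ (dup X) (a ∷ A)) ⟩
  map₂ (x ∷_) (pairUp (merge≥ (dup X) (a ∷ A)))  ≡⟨ cong (map₂ (x ∷_)) rec ⟩
  a ∷ A , x ∷ X                                  ∎
  where open ≡-Reasoning
... | no  x≱a | _ | rec = begin
  pairUp (merge≥ (dup (x ∷ X)) (a ∷ A))          ≡⟨ cong pairUp (merge≥-< (x ∷ dup X) A x<a) ⟩
  pairUp (a ∷ merge≥ (dup (x ∷ X)) A)
    ≡⟨ pairUp-∷ (merge≥ (dup (x ∷ X)) A)
                (All-merge≥ (All-dup (Linked≥⇒All< x<a X↓)) (∷-Linked⁻ >-trans A↓)) ⟩
  map₁ (a ∷_) (pairUp (merge≥ (dup (x ∷ X)) A))  ≡⟨ cong (map₁ (a ∷_)) rec ⟩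
  a ∷ A , x ∷ X                                  ∎
  where
  open ≡-Reasoning
  x<a = ≰⇒> x≱a

Odd : Pred ℕ 0ℓ
Odd n = parity n ≡ 1ℙ

odd? : Decidable Odd
odd? n = parity n ℙ.≟ 1ℙ

Odd-irrelevant : ∀ {n} → Irrelevant (Odd n)
Odd-irrelevant = Decidable⇒UIP.≡-irrelevant ℙ._≟_

odds evens halves : List ℕ → List ℕ
odds     = filter odd?
evens    = filter (∁? odd?)
halves μ = map ⌊_/2⌋ (evens μ)

odd⇒>0 : ∀ {n} → Odd n → 0 < n
odd⇒>0 {suc n} _ = s≤s z≤n

¬odd-double : ∀ n → ¬ Odd (double n)
¬odd-double n odd with () ← trans (sym (trans (ℙ.+-homo-+ n n) (ℙ.p+p≡0ℙ (parity n)))) odd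

double-⌊/2⌋ : ∀ {n} → ¬ Odd n → double ⌊ n /2⌋ ≡ n
double-⌊/2⌋ {zero}        _    = refl
double-⌊/2⌋ {suc zero}    ¬odd = ⊥-elim (¬odd refl)
double-⌊/2⌋ {suc (suc n)} ¬odd =
  trans (cong suc (+-suc ⌊ n /2⌋ ⌊ n /2⌋)) (cong (suc ∘ suc) (double-⌊/2⌋ ¬odd))

map-⌊/2⌋-double : ∀ xs → map ⌊_/2⌋ (map double xs) ≡ xs
map-⌊/2⌋-double xs = trans (sym (map-∘ xs)) (trans (map-cong (sym ∘ n≡⌊n+n/2⌋) xs) (map-id xs))

map-double-⌊/2⌋ : ∀ {xs} → All (∁ Odd) xs → map double (map ⌊_/2⌋ xs) ≡ xs
map-double-⌊/2⌋ {xs} even = trans (sym (map-∘ xs)) (map-id-local (All.map double-⌊/2⌋ even))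

sum-map-double : ∀ xs → sum (map double xs) ≡ double (sum xs)
sum-map-double []       = refl
sum-map-double (x ∷ xs) = trans (cong (double x +_) (sum-map-double xs)) (rearrange x (sum xs))
  where
  rearrange : ∀ a b → a + a + (b + b) ≡ a + b + (a + b)
  rearrange = solve-∀

double≤1+⇒≤ : ∀ {n f} → double n ≤ suc f → n ≤ f
double≤1+⇒≤ {zero}  _          = z≤n
double≤1+⇒≤ {suc n} (s≤s 2n≤f) = ≤-trans (m≤n+m (suc n) n) 2n≤f

map-⌊/2⌋-strict : ∀ {xs} → All (∁ Odd) xs → Linked _>_ xs → Linked _>_ (map ⌊_/2⌋ xs)
map-⌊/2⌋-strict _               []          = []
map-⌊/2⌋-strict _               [-]         = [-]
map-⌊/2⌋-strict (¬ox ∷ ¬oy ∷ e) (y<x ∷ yr↓) = ⌊y/2⌋<⌊x/2⌋ ∷ map-⌊/2⌋-strict (¬oy ∷ e) yr↓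
  where
  ⌊y/2⌋<⌊x/2⌋ = ≰⇒> λ ⌊x/2⌋≤⌊y/2⌋ → <⇒≱ y<x
    (subst₂ _≤_ (double-⌊/2⌋ ¬ox) (double-⌊/2⌋ ¬oy) (+-mono-≤ ⌊x/2⌋≤⌊y/2⌋ ⌊x/2⌋≤⌊y/2⌋))

map-⌊/2⌋-positive : ∀ {xs} → All (∁ Odd) xs → All (0 <_) xs → All (0 <_) (map ⌊_/2⌋ xs)
map-⌊/2⌋-positive {[]}              []       []      = []
map-⌊/2⌋-positive {zero ∷ _}        _        (() ∷ _)
map-⌊/2⌋-positive {suc zero ∷ _}    (¬o ∷ _) _       = ⊥-elim (¬o refl)
map-⌊/2⌋-positive {suc (suc x) ∷ _} (_ ∷ e)  (_ ∷ p) = s≤s z≤n ∷ map-⌊/2⌋-positive e p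

halves-Strict : ∀ {μ} → Strict μ → Strict (halves μ)
halves-Strict {μ} (μ↓ , μ>0) =
  map-⌊/2⌋-strict (All.all-filter (∁? odd?) μ) (Linked.filter⁺ (∁? odd?) >-trans μ↓) ,
  map-⌊/2⌋-positive (All.all-filter (∁? odd?) μ) (All.filter⁺ (∁? odd?) μ>0)

double-sum-halves : ∀ μ → double (sum (halves μ)) ≡ sum (evens μ)
double-sum-halves μ = trans (sym (sum-map-double (halves μ)))
                            (cong sum (map-double-⌊/2⌋ (All.all-filter (∁? odd?) μ)))

sum-evens-odds : ∀ {μ} → Linked _≥_ μ → sum (evens μ) + sum (odds μ) ≡ sum μ
sum-evens-odds {μ} μ↓ =
  trans (sym (sum-merge≥ (evens μ) (odds μ))) (cong sum (merge≥-filter odd? μ↓))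

sum-halves≤ : ∀ {μ f} → Linked _≥_ μ → sum μ ≤ suc f → sum (halves μ) ≤ f
sum-halves≤ {μ} {f} μ↓ μ≤1+f = double≤1+⇒≤ (begin
  double (sum (halves μ))        ≡⟨ double-sum-halves μ ⟩
  sum (evens μ)                  ≤⟨ m≤m+n _ _ ⟩
  sum (evens μ) + sum (odds μ)   ≡⟨ sum-evens-odds μ↓ ⟩
  sum μ                          ≤⟨ μ≤1+f ⟩
  suc f                          ∎)
  where open ≤-Reasoning

sum-pairUp : ∀ {ν} → Linked _≥_ ν → double (sum (pairs ν)) + sum (singles ν) ≡ sum ν
sum-pairUp {ν} ν↓ = begin
  double (sum (pairs ν)) + sum (singles ν)    ≡⟨ cong (_+ sum (singles ν)) (sum-dup (pairs ν)) ⟨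
  sum (dup (pairs ν)) + sum (singles ν)       ≡⟨ sum-merge≥ (dup (pairs ν)) (singles ν) ⟨
  sum (merge≥ (dup (pairs ν)) (singles ν))    ≡⟨ cong sum (merge≥-dup-pairUp ν↓) ⟩
  sum ν                                       ∎
  where open ≡-Reasoning

sum-pairs≤ : ∀ {ν f} → Linked _≥_ ν → sum ν ≤ suc f → sum (pairs ν) ≤ f
sum-pairs≤ {ν} {f} ν↓ ν≤1+f = double≤1+⇒≤ (begin
  double (sum (pairs ν))                      ≤⟨ m≤m+n _ _ ⟩
  double (sum (pairs ν)) + sum (singles ν)    ≡⟨ sum-pairUp ν↓ ⟩
  sum ν                                       ≤⟨ ν≤1+f ⟩
  suc f                                       ∎)
  where open ≤-Reasoning

sum≤0⇒[] : ∀ {xs} → All (0 <_) xs → sum xs ≤ 0 → [] ≡ xs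
sum≤0⇒[] []        _   = refl
sum≤0⇒[] (0<x ∷ _) s≤0 = ⊥-elim (<⇒≱ 0<x (m+n≤o⇒m≤o _ s≤0))

-- Glaisher's bijection

-- The first argument is fuel: each recursive call at least halves the size of the
-- partition, so any bound on the size is enough.
toOddParts : ℕ → List ℕ → List ℕ
toOddParts zero    _ = []
toOddParts (suc f) μ = merge≥ (dup (toOddParts f (halves μ))) (odds μ)

toDistinctParts : ℕ → List ℕ → List ℕ
toDistinctParts zero    _ = []
toDistinctParts (suc f) ν = merge≥ (map double (toDistinctParts f (pairs ν))) (singles ν)

toOddParts-odd : ∀ f {μ} → Strict μ → Linked _≥_ (toOddParts f μ) × All Odd (toOddParts f μ)
toOddParts-odd zero    _  = [] , []
toOddParts-odd (suc f) {μ} sμ = let (ν↓ , ν-odd) = toOddParts-odd f (halves-Strict sμ) in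
  merge≥-decreasing (dup-decreasing ν↓) (Linked.filter⁺ odd? ≥-trans (Strict⇒decreasing sμ)) ,
  All-merge≥ (All-dup ν-odd) (All.all-filter odd? μ)

toDistinctParts-strict : ∀ f {ν} → Linked _≥_ ν → All Odd ν → Strict (toDistinctParts f ν)
toDistinctParts-strict zero    _  _     = [] , []
toDistinctParts-strict (suc f) {ν} ν↓ ν-odd =
  let (s↓ , p↓)       = pairUp-decreasing ν↓
      (s-odd , p-odd) = All-pairUp ν ν-odd
      (μ↓ , μ>0)      = toDistinctParts-strict f p↓ p-odd
  in merge≥-strict odd? _ _ (All.map⁺ (All.universal ¬odd-double _)) s-odd
       (Linked.map⁺ (Linked.map (λ y<x → +-mono-< y<x y<x) μ↓)) s↓ ,
     All-merge≥ (All.map⁺ (All.map (λ 0<x → <-≤-trans 0<x (m≤m+n _ _)) μ>0)) (All.map odd⇒>0 s-odd)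

sum-toOddParts : ∀ f {μ} → Strict μ → sum μ ≤ f → sum (toOddParts f μ) ≡ sum μ
sum-toOddParts zero    _  μ≤0 = sym (n≤0⇒n≡0 μ≤0)
sum-toOddParts (suc f) {μ} sμ μ≤1+f = begin
  sum (merge≥ (dup ν) (odds μ))            ≡⟨ sum-merge≥ (dup ν) (odds μ) ⟩
  sum (dup ν) + sum (odds μ)               ≡⟨ cong (_+ sum (odds μ)) (sum-dup ν) ⟩
  double (sum ν) + sum (odds μ)
    ≡⟨ cong (λ s → double s + sum (odds μ))
            (sum-toOddParts f (halves-Strict sμ) (sum-halves≤ μ↓ μ≤1+f)) ⟩
  double (sum (halves μ)) + sum (odds μ)   ≡⟨ cong (_+ sum (odds μ)) (double-sum-halves μ) ⟩
  sum (evens μ) + sum (odds μ)             ≡⟨ sum-evens-odds μ↓ ⟩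
  sum μ                                    ∎
  where
  open ≡-Reasoning
  ν = toOddParts f (halves μ)
  μ↓ = Strict⇒decreasing sμ

sum-toDistinctParts : ∀ f {ν} → Linked _≥_ ν → All Odd ν → sum ν ≤ f →
  sum (toDistinctParts f ν) ≡ sum ν
sum-toDistinctParts zero    _  _     ν≤0 = sym (n≤0⇒n≡0 ν≤0)
sum-toDistinctParts (suc f) {ν} ν↓ ν-odd ν≤1+f = begin
  sum (merge≥ (map double μ) (singles ν))     ≡⟨ sum-merge≥ (map double μ) (singles ν) ⟩
  sum (map double μ) + sum (singles ν)        ≡⟨ cong (_+ sum (singles ν)) (sum-map-double μ) ⟩
  double (sum μ) + sum (singles ν)
    ≡⟨ cong (λ s → double s + sum (singles ν))
            (sum-toDistinctParts f p↓ p-odd (sum-pairs≤ ν↓ ν≤1+f)) ⟩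
  double (sum (pairs ν)) + sum (singles ν)    ≡⟨ sum-pairUp ν↓ ⟩
  sum ν                                       ∎
  where
  open ≡-Reasoning
  p↓    = proj₂ (pairUp-decreasing ν↓)
  p-odd = proj₂ (All-pairUp ν ν-odd)
  μ     = toDistinctParts f (pairs ν)

toDistinctParts∘toOddParts : ∀ f {μ} → Strict μ → sum μ ≤ f →
  toDistinctParts f (toOddParts f μ) ≡ μ
toDistinctParts∘toOddParts zero    (_ , μ>0) μ≤0 = sum≤0⇒[] μ>0 μ≤0
toDistinctParts∘toOddParts (suc f) {μ} sμ μ≤1+f = begin
  merge≥ (map double (toDistinctParts f (pairs X))) (singles X)
    ≡⟨ cong (λ p → merge≥ (map double (toDistinctParts f (proj₂ p))) (proj₁ p))
            (pairUp-merge≥-dup (odds μ) ν (Linked.filter⁺ odd? >-trans (proj₁ sμ)) ν↓) ⟩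
  merge≥ (map double (toDistinctParts f ν)) (odds μ)
    ≡⟨ cong (λ t → merge≥ (map double t) (odds μ))
            (toDistinctParts∘toOddParts f (halves-Strict sμ) (sum-halves≤ μ↓ μ≤1+f)) ⟩
  merge≥ (map double (halves μ)) (odds μ)
    ≡⟨ cong (λ t → merge≥ t (odds μ)) (map-double-⌊/2⌋ (All.all-filter (∁? odd?) μ)) ⟩
  merge≥ (evens μ) (odds μ)
    ≡⟨ merge≥-filter odd? μ↓ ⟩
  μ ∎
  where
  open ≡-Reasoning
  ν  = toOddParts f (halves μ)
  X  = merge≥ (dup ν) (odds μ)
  ν↓ = proj₁ (toOddParts-odd f (halves-Strict sμ))
  μ↓ = Strict⇒decreasing sμ

toOddParts∘toDistinctParts : ∀ f {ν} → Linked _≥_ ν → All Odd ν → sum ν ≤ f →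
  toOddParts f (toDistinctParts f ν) ≡ ν
toOddParts∘toDistinctParts zero    _  ν-odd ν≤0 = sum≤0⇒[] (All.map odd⇒>0 ν-odd) ν≤0
toOddParts∘toDistinctParts (suc f) {ν} ν↓ ν-odd ν≤1+f = begin
  merge≥ (dup (toOddParts f (halves X))) (odds X)
    ≡⟨ cong₂ (λ e o → merge≥ (dup (toOddParts f (map ⌊_/2⌋ e))) o) evens≡ odds≡ ⟩
  merge≥ (dup (toOddParts f (map ⌊_/2⌋ (map double μ)))) (singles ν)
    ≡⟨ cong (λ t → merge≥ (dup (toOddParts f t)) (singles ν)) (map-⌊/2⌋-double μ) ⟩
  merge≥ (dup (toOddParts f μ)) (singles ν)
    ≡⟨ cong (λ t → merge≥ (dup t) (singles ν))
            (toOddParts∘toDistinctParts f p↓ p-odd (sum-pairs≤ ν↓ ν≤1+f)) ⟩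
  merge≥ (dup (pairs ν)) (singles ν)
    ≡⟨ merge≥-dup-pairUp ν↓ ⟩
  ν ∎
  where
  open ≡-Reasoning
  p↓    = proj₂ (pairUp-decreasing ν↓)
  p-odd = proj₂ (All-pairUp ν ν-odd)
  μ     = toDistinctParts f (pairs ν)
  X     = merge≥ (map double μ) (singles ν)
  filters = filter-merge≥ odd? (map double μ) (singles ν)
              (All.map⁺ (All.universal ¬odd-double _)) (proj₁ (All-pairUp ν ν-odd))
  odds≡  = proj₁ filters
  evens≡ = proj₂ filters

OddHalfPartition : ℕ → Set
OddHalfPartition n = Σ[ ν ∈ List ℕ ] (Linked _≥_ ν × All Odd ν) × sum ν + sum ν ≡ n

OddHalfPartition-≡ : ∀ {n} {x y : OddHalfPartition n} → proj₁ x ≡ proj₁ y → x ≡ y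
OddHalfPartition-≡ = Σ-≡ λ _ ((ν↓ , odd) , eq) ((ν↓′ , odd′) , eq′) → cong₂ _,_
  (cong₂ _,_ (Linked.irrelevant ≤-irrelevant ν↓ ν↓′)
             (All.irrelevant (λ {x} → Odd-irrelevant {x}) odd odd′))
  (≡-irrelevant eq eq′)

strictHalf↔oddHalf : ∀ n → StrictHalfPartition n ↔ OddHalfPartition n
strictHalf↔oddHalf n = mk↔ₛ′ to from to∘from from∘to
  where
  half≤ : ∀ {s} → s + s ≡ n → s ≤ n
  half≤ {s} 2s≡n = subst (s ≤_) 2s≡n (m≤m+n s s)

  to : StrictHalfPartition n → OddHalfPartition n
  to (μ , sμ , 2μ≡n) = toOddParts n μ , toOddParts-odd n sμ ,
    trans (cong double (sum-toOddParts n sμ (half≤ 2μ≡n))) 2μ≡n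

  from : OddHalfPartition n → StrictHalfPartition n
  from (ν , (ν↓ , ν-odd) , 2ν≡n) = toDistinctParts n ν , toDistinctParts-strict n ν↓ ν-odd ,
    trans (cong double (sum-toDistinctParts n ν↓ ν-odd (half≤ 2ν≡n))) 2ν≡n

  to∘from : ∀ y → to (from y) ≡ y
  to∘from (ν , (ν↓ , ν-odd) , 2ν≡n) =
    OddHalfPartition-≡ (toOddParts∘toDistinctParts n ν↓ ν-odd (half≤ 2ν≡n))

  from∘to : ∀ x → from (to x) ≡ x
  from∘to (μ , sμ , 2μ≡n) = StrictHalfPartition-≡ (toDistinctParts∘toOddParts n sμ (half≤ 2μ≡n))

-- Parts congruent to 2 modulo 4

4+-%4 : ∀ m → (4 + m) % 4 ≡ m % 4
4+-%4 m = trans (cong (_% 4) (+-comm 4 m)) ([m+n]%n≡m%n m 4)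

odd⇒double%4≡2 : ∀ {o} → Odd o → double o % 4 ≡ 2
odd⇒double%4≡2 {suc zero}    _   = refl
odd⇒double%4≡2 {suc (suc o)} odd = begin
  double (2 + o) % 4      ≡⟨ cong (λ t → (2 + t) % 4) (+-suc o (suc o)) ⟩
  (3 + (o + suc o)) % 4   ≡⟨ cong (λ t → (3 + t) % 4) (+-suc o o) ⟩
  (4 + double o) % 4      ≡⟨ 4+-%4 (double o) ⟩
  double o % 4            ≡⟨ odd⇒double%4≡2 {o} odd ⟩
  2                       ∎
  where open ≡-Reasoning

%4≡2⇒odd-⌊/2⌋ : ∀ {n} → n % 4 ≡ 2 → Odd ⌊ n /2⌋ × ¬ Odd n
%4≡2⇒odd-⌊/2⌋ {2}                       _     = refl , λ ()
%4≡2⇒odd-⌊/2⌋ {suc (suc (suc (suc n)))} n%4≡2 = %4≡2⇒odd-⌊/2⌋ {n} (trans (sym (4+-%4 n)) n%4≡2)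

oddHalf↔parts2mod4 : ∀ n → OddHalfPartition n ↔ Σ (Partition n) (AllParts2mod4 ∘ proj₁)
oddHalf↔parts2mod4 n = mk↔ₛ′ to from to∘from from∘to
  where
  to : OddHalfPartition n → Σ (Partition n) (AllParts2mod4 ∘ proj₁)
  to (ν , (ν↓ , ν-odd) , 2ν≡n) = (map double ν , record
    { decreasing = Linked.map⁺ (Linked.map (λ y≤x → +-mono-≤ y≤x y≤x) ν↓)
    ; positive   = All.map⁺ (All.map (λ {x} odd → <-≤-trans (odd⇒>0 {x} odd) (m≤m+n x x)) ν-odd)
    ; sums       = trans (sum-map-double ν) 2ν≡n
    }) , All.map⁺ (All.map (λ {o} → odd⇒double%4≡2 {o}) ν-odd)

  halve : ∀ {λs} → AllParts2mod4 λs → All Odd (map ⌊_/2⌋ λs) × map double (map ⌊_/2⌋ λs) ≡ λs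
  halve λs%4 = let (odd , ¬odd) = All.unzip (All.map (λ {p} → %4≡2⇒odd-⌊/2⌋ {p}) λs%4) in
    All.map⁺ odd , map-double-⌊/2⌋ ¬odd

  from : Σ (Partition n) (AllParts2mod4 ∘ proj₁) → OddHalfPartition n
  from ((λs , p) , λs%4) = let (odd , λs≡) = halve λs%4 in
    map ⌊_/2⌋ λs , (Linked.map⁺ (Linked.map ⌊n/2⌋-mono (IsPartition.decreasing p)) , odd) ,
    trans (sym (sum-map-double (map ⌊_/2⌋ λs))) (trans (cong sum λs≡) (IsPartition.sums p))

  to∘from : ∀ x → to (from x) ≡ x
  to∘from ((λs , _) , λs%4) = Partition-≡ (λ _ → All.irrelevant ≡-irrelevant) (proj₂ (halve λs%4))

  from∘to : ∀ y → from (to y) ≡ y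
  from∘to (ν , _ , _) = OddHalfPartition-≡ (map-⌊/2⌋-double ν)

corollary2p7 : (n : ℕ) → .{{_ : NonZero n}} →
    (Σ (Partition n) (λ p → NoZeroSpContent (proj₁ p)))
      ↔ (Σ (Partition n) (λ p → AllParts2mod4 (proj₁ p)))
corollary2p7 n =
  ↔-trans (noZeroSp↔strictHalf n) (↔-trans (strictHalf↔oddHalf n) (oddHalf↔parts2mod4 n))
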